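{- The function $h(z)=1-2z+z\widehat{x}_{0,0}(z)$ satisfies $$h(z)=1+2z\Big(-1-\alpha_0+\sum_{k=0}^{\infty}(-1)^kT_k\Big),\qquad T_k=\begin{cases}\beta_{k/2}\,\alpha_{k/2}&\text{if }k\text{ is even},\\ \beta_{(k-1)/2}\,\alpha_{(k+1)/2}&\text{if }k\text{ is odd}.\end{cases}$$
   Context: Here (as formal power series in $z$, or analytic functions for $|z|<1/\sqrt8$ with the principal branch of $\sqrt{\cdot}$): $\alpha_0=\frac{1-\sqrt{1-8z^2}}{4z}$, $\beta_0=\frac{\alpha_0^2}{1+\alpha_0^2}$, $f(t)=\frac{1-\sqrt{1-4z^{2}(1+t^2)}}{2z(1+t^2)}\,t$, $\alpha_{k+1}=f(\beta_k)$ for $k\ge0$, $\beta_k=f(\alpha_k)$ for $k\ge1$, and $\widehat{x}_{0,0}=2\sum_{k\ge0}(1-\beta_k)(\alpha_{k+1}-\alpha_k)$. -}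

module Defs where

open import Data.Nat as ℕ using (ℕ; zero; suc; _∸_; ⌊_/2⌋; ⌈_/2⌉)
open import Data.Rational as ℚ using (ℚ; 0ℚ; 1ℚ; ½; _+_; _*_; _-_; -_)
open import Data.List using (List; []; _∷_; _++_)
open import Data.Product using (_×_; _,_; proj₁; proj₂; ∃-syntax)
open import Relation.Binary.PropositionalEquality using (_≡_)
open import Data.Integer using (+_)

q2 q4 q8 ¼ : ℚ
q2 = + 2 ℚ./ 1
q4 = + 4 ℚ./ 1
q8 = + 8 ℚ./ 1
¼ = + 1 ℚ./ 4

-- Formal power series in z with rational coefficients: n ↦ coefficient of z^n.
Series : Set
Series = ℕ → ℚ

Σ< : ℕ → (ℕ → ℚ) → ℚ
Σ< zero    f = 0ℚ
Σ< (suc n) f = Σ< n f + f n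

const : ℚ → Series
const c zero    = c
const c (suc n) = 0ℚ

zS : Series
zS 1 = 1ℚ
zS _ = 0ℚ

_⊕_ : Series → Series → Series
(a ⊕ b) n = a n + b n

_⊖_ : Series → Series → Series
(a ⊖ b) n = a n - b n

scale : ℚ → Series → Series
scale c a n = c * a n

_⊛_ : Series → Series → Series
(a ⊛ b) n = Σ< (suc n) (λ i → a i * b (n ∸ i))

infixl 6 _⊕_ _⊖_
infixl 7 _⊛_

-- Division by z (only used on series with zero constant term): drop the z^0 coefficient.
divZ : Series → Series
divZ a n = a (suc n)

_≈S_ : Series → Series → Set
a ≈S b = ∀ n → a n ≡ b n

-- Series defined by coefficient recursion: step n g computes the n-th
-- coefficient from the earlier ones g 0, ..., g (n-1).
private
  get : List ℚ → ℕ → ℚ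
  get []       _       = 0ℚ
  get (x ∷ xs) zero    = x
  get (x ∷ xs) (suc n) = get xs n

  table : (ℕ → (ℕ → ℚ) → ℚ) → ℕ → List ℚ
  table step zero    = step zero (λ _ → 0ℚ) ∷ []
  table step (suc n) = table step n ++ (step (suc n) (get (table step n)) ∷ [])

recSeries : (ℕ → (ℕ → ℚ) → ℚ) → Series
recSeries step n = get (table step n) n

-- Principal square root of a series with constant term 1:
-- the unique s with s ⊛ s ≈S a and s 0 = 1.
-- s (n+1) = (a (n+1) - Σ_{i=1}^{n} s i * s (n+1-i)) / 2.
sqrt1 : Series → Series
sqrt1 a = recSeries step
  where
  step : ℕ → (ℕ → ℚ) → ℚ
  step zero    g = 1ℚ
  step (suc n) g = (a (suc n) - Σ< n (λ j → g (suc j) * g (n ∸ j))) * ½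

-- Multiplicative inverse of a series with constant term 1:
-- b 0 = 1, b (n+1) = - Σ_{i=1}^{n+1} a i * b (n+1-i).
inv1 : Series → Series
inv1 a = recSeries step
  where
  step : ℕ → (ℕ → ℚ) → ℚ
  step zero    g = 1ℚ
  step (suc n) g = - Σ< (suc n) (λ j → a (suc j) * g (n ∸ j))

-- α₀ = (1 - √(1 - 8z²)) / (4z)
α₀ : Series
α₀ = scale ¼ (divZ (const 1ℚ ⊖ sqrt1 (const 1ℚ ⊖ scale q8 (zS ⊛ zS))))

-- f(t) = (1 - √(1 - 4z²(1+t²))) / (2z(1+t²)) · t
fS : Series → Series
fS t = scale ½ (divZ (const 1ℚ ⊖ sqrt1 (const 1ℚ ⊖ scale q4 (zS ⊛ zS ⊛ onePlusT²))))
       ⊛ inv1 onePlusT² ⊛ t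
  where
  onePlusT² : Series
  onePlusT² = const 1ℚ ⊕ t ⊛ t

αβ : ℕ → Series × Series
αβ zero    = α₀ , (α₀ ⊛ α₀ ⊛ inv1 (const 1ℚ ⊕ α₀ ⊛ α₀))
αβ (suc k) = let a = fS (proj₂ (αβ k)) in a , fS a

α : ℕ → Series
α k = proj₁ (αβ k)

β : ℕ → Series
β k = proj₂ (αβ k)

psum : (ℕ → Series) → ℕ → Series
psum F M n = Σ< M (λ k → F k n)

-- z-adic (coefficient-wise eventually constant) convergence of Σ_k F k to L
SumsTo : (ℕ → Series) → Series → Set
SumsTo F L = ∀ n → ∃[ N ] (∀ M → N ℕ.≤ M → psum F M n ≡ L n)

-- summands of x̂₀,₀ = 2 Σ_k (1-β_k)(α_{k+1}-α_k)
xTerm : ℕ → Series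
xTerm k = scale q2 ((const 1ℚ ⊖ β k) ⊛ (α (suc k) ⊖ α k))

sign : ℕ → ℚ
sign zero    = 1ℚ
sign (suc k) = - sign k

-- T_k = β_{k/2} α_{k/2} (k even), β_{(k-1)/2} α_{(k+1)/2} (k odd);
-- uniformly: β_{⌊k/2⌋} α_{⌈k/2⌉}.
T : ℕ → Series
T k = β ⌊ k /2⌋ ⊛ α ⌈ k /2⌉

tTerm : ℕ → Series
tTerm k = scale (sign k) (T k)

h : Series → Series
h x̂ = const 1ℚ ⊖ scale q2 zS ⊕ zS ⊛ x̂

-- Expanding each summand gives
--   (1-βₖ)(αₖ₊₁-αₖ) = (αₖ₊₁ - αₖ) + (βₖαₖ - βₖαₖ₊₁),
-- so the first parts telescope to (α_N - α₀), while the pairs βₖαₖ, -βₖαₖ₊₁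
-- are exactly the even and odd terms T₂ₖ, -T₂ₖ₊₁ of the alternating series.
-- Everything is made rigorous coefficient by coefficient using z-adic orders:
-- f(t) = z·(…)·t raises the order by one, hence αₖ and βₖ have order ≥ k.
-- Consequently the k-th summands of both series vanish below z^⌊k/2⌋, so both
-- series converge z-adically, and at the coefficient of z^n the telescoped
-- boundary term α_{n+1} contributes nothing, giving x̂₀,₀ = 2(S - α₀).
module Submission where

open import Defs
open import Data.Rational using (1ℚ)
open import Data.Product using (_×_; ∃-syntax)

open import Data.Rational as ℚ using (ℚ; 0ℚ; ½; _+_; _*_; _-_; -_)
open import Data.Rational.Properties as ℚP using ()
open import Data.Nat as ℕ using (ℕ; zero; suc; _∸_; _<_; _≤_; z≤n; s≤s; ⌊_/2⌋; ⌈_/2⌉; _≤′_; ≤′-reflexive; ≤′-step)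
open import Data.Nat.Properties as ℕP using ()
open import Data.Product using (_,_)
open import Relation.Nullary using (yes; no)
open import Relation.Binary.PropositionalEquality
open import Data.Rational.Solver using (module +-*-Solver)
open +-*-Solver using (solve; _:+_; _:-_; _:*_; :-_; con; _:=_)

Σ<-zero : ∀ N f → (∀ i → i < N → f i ≡ 0ℚ) → Σ< N f ≡ 0ℚ
Σ<-zero zero    f f≡0 = refl
Σ<-zero (suc N) f f≡0
  rewrite Σ<-zero N f (λ i i<N → f≡0 i (ℕP.m≤n⇒m≤1+n i<N)) | f≡0 N ℕP.≤-refl = refl

Σ<-cong : ∀ N f g → (∀ i → f i ≡ g i) → Σ< N f ≡ Σ< N g
Σ<-cong zero    f g f≡g = refl
Σ<-cong (suc N) f g f≡g = cong₂ _+_ (Σ<-cong N f g f≡g) (f≡g N)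

Σ<-sub : ∀ N f g → Σ< N (λ i → f i - g i) ≡ Σ< N f - Σ< N g
Σ<-sub zero    f g = refl
Σ<-sub (suc N) f g rewrite Σ<-sub N f g =
  solve 4 (λ a b c d → (a :- b) :+ (c :- d) := (a :+ c) :- (b :+ d)) refl
    (Σ< N f) (Σ< N g) (f N) (g N)

Σ<-scale : ∀ c N f → Σ< N (λ i → c * f i) ≡ c * Σ< N f
Σ<-scale c zero    f = sym (ℚP.*-zeroʳ c)
Σ<-scale c (suc N) f rewrite Σ<-scale c N f = sym (ℚP.*-distribˡ-+ c (Σ< N f) (f N))

double : ℕ → ℕ
double zero    = zero
double (suc k) = suc (suc (double k))

Σ<-pairs : ∀ F N → Σ< (double N) F ≡ Σ< N (λ k → F (double k) + F (suc (double k)))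
Σ<-pairs F zero    = refl
Σ<-pairs F (suc N) rewrite Σ<-pairs F N =
  ℚP.+-assoc (Σ< N (λ k → F (double k) + F (suc (double k)))) (F (double N)) (F (suc (double N)))

OrderAtLeast : ℕ → Series → Set
OrderAtLeast m s = ∀ j → j < m → s j ≡ 0ℚ

order-zero : ∀ s → OrderAtLeast 0 s
order-zero s j ()

order-mono : ∀ {m m′} s → m ≤ m′ → OrderAtLeast m′ s → OrderAtLeast m s
order-mono s m≤m′ ord j j<m = ord j (ℕP.<-≤-trans j<m m≤m′)

order-⊖ : ∀ m a b → OrderAtLeast m a → OrderAtLeast m b → OrderAtLeast m (a ⊖ b)
order-⊖ m a b ord-a ord-b j j<m rewrite ord-a j j<m | ord-b j j<m = refl

-- Orders add under the Cauchy product: in a i · b (n-i) with n < p+q,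
-- either i < p, or p ≤ i and then n - i < q.
order-⊛ : ∀ p q a b → OrderAtLeast p a → OrderAtLeast q b → OrderAtLeast (p ℕ.+ q) (a ⊛ b)
order-⊛ p q a b ord-a ord-b n n<p+q = Σ<-zero (suc n) _ term≡0
  where
  term≡0 : ∀ i → i < suc n → a i * b (n ∸ i) ≡ 0ℚ
  term≡0 i i≤n with i ℕP.<? p
  ... | yes i<p = trans (cong (_* b (n ∸ i)) (ord-a i i<p)) (ℚP.*-zeroˡ (b (n ∸ i)))
  ... | no  i≮p = trans (cong (a i *_) (ord-b (n ∸ i) n∸i<q)) (ℚP.*-zeroʳ (a i))
    where
    p≤i : p ≤ i
    p≤i = ℕP.≮⇒≥ i≮p
    n∸p<q : n ∸ p < q
    n∸p<q = subst (n ∸ p <_) (ℕP.m+n∸m≡n p q)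
              (ℕP.∸-monoˡ-< n<p+q (ℕP.≤-trans p≤i (ℕP.≤-pred i≤n)))
    n∸i<q : n ∸ i < q
    n∸i<q = ℕP.≤-<-trans (ℕP.∸-monoʳ-≤ n p≤i) n∸p<q

-- The prefactor (1 - √(1 - 4z²c)) / (2z) of f has order ≥ 1 for every c:
-- the z¹ coefficient of 1 - 4z²c vanishes, hence so does that of its root.
root-prefactor-order : ∀ c →
  OrderAtLeast 1 (scale ½ (divZ (const 1ℚ ⊖ sqrt1 (const 1ℚ ⊖ scale q4 (zS ⊛ zS ⊛ c)))))
root-prefactor-order c zero _ =
  cong (λ x → ½ * (0ℚ - (0ℚ - q4 * x - 0ℚ) * ½)) (order-⊛ 2 0 (zS ⊛ zS) c z²-order (order-zero c) 1 (s≤s (s≤s z≤n)))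
  where
  z-order : OrderAtLeast 1 zS
  z-order zero _ = refl
  z-order (suc j) (s≤s ())
  z²-order : OrderAtLeast 2 (zS ⊛ zS)
  z²-order = order-⊛ 1 1 zS zS z-order z-order
root-prefactor-order c (suc j) (s≤s ())

-- f(t) = prefactor · (1+t²)⁻¹ · t raises the order of t by one.
f-raises-order : ∀ m t → OrderAtLeast m t → OrderAtLeast (suc m) (fS t)
f-raises-order m t ord-t =
  order-⊛ 1 m (prefactor ⊛ inv1 1+t²) t
    (order-⊛ 1 0 prefactor (inv1 1+t²) (root-prefactor-order 1+t²) (order-zero _)) ord-t
  where
  1+t² prefactor : Series
  1+t² = const 1ℚ ⊕ t ⊛ t
  prefactor = scale ½ (divZ (const 1ℚ ⊖ sqrt1 (const 1ℚ ⊖ scale q4 (zS ⊛ zS ⊛ 1+t²))))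

mutual
  α-order : ∀ k → OrderAtLeast k (α k)
  α-order zero    = order-zero _
  α-order (suc k) = f-raises-order k (β k) (β-order k)

  β-order : ∀ k → OrderAtLeast k (β k)
  β-order zero    = order-zero _
  β-order (suc k) = order-mono (β (suc k)) (ℕP.n≤1+n (suc k))
                      (f-raises-order (suc k) (α (suc k)) (α-order (suc k)))

psum-stable : ∀ F n N M → (∀ k → N ≤ k → F k n ≡ 0ℚ) → N ≤′ M → psum F M n ≡ psum F N n
psum-stable F n N .N vanish (≤′-reflexive refl) = refl
psum-stable F n N (suc M) vanish (≤′-step N≤M)
  rewrite psum-stable F n N M vanish N≤M | vanish M (ℕP.≤′⇒≤ N≤M) = ℚP.+-identityʳ _

eventually-vanishing-sums : ∀ F (bound : ℕ → ℕ) → (∀ n k → bound n ≤ k → F k n ≡ 0ℚ)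
  → SumsTo F (λ n → psum F (bound n) n)
eventually-vanishing-sums F bound vanish n =
  bound n , λ M bound≤M → psum-stable F n (bound n) M (vanish n) (ℕP.≤⇒≤′ bound≤M)

-- The summands of x̂₀,₀ have order ≥ k, since αₖ₊₁ - αₖ has.
xTerm-vanishes : ∀ n k → suc n ≤ k → xTerm k n ≡ 0ℚ
xTerm-vanishes n k n<k = cong (q2 *_)
  (order-⊛ 0 k (const 1ℚ ⊖ β k) (α (suc k) ⊖ α k) (order-zero _)
    (order-⊖ k _ _ (order-mono (α (suc k)) (ℕP.n≤1+n k) (α-order (suc k))) (α-order k)) n n<k)

double≤⇒≤half : ∀ n k → double n ≤ k → n ≤ ⌊ k /2⌋
double≤⇒≤half zero    k       _                 = z≤n
double≤⇒≤half (suc n) (suc (suc k)) (s≤s (s≤s le)) = s≤s (double≤⇒≤half n k le)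

-- Tₖ = β_{⌊k/2⌋} α_{⌈k/2⌉} has order ≥ ⌊k/2⌋, since β_{⌊k/2⌋} has.
tTerm-vanishes : ∀ n k → double (suc n) ≤ k → tTerm k n ≡ 0ℚ
tTerm-vanishes n k le = trans
  (cong (sign k *_) (order-⊛ ⌊ k /2⌋ 0 (β ⌊ k /2⌋) (α ⌈ k /2⌉) (β-order ⌊ k /2⌋) (order-zero _) n
    (subst (suc n ≤_) (sym (ℕP.+-identityʳ ⌊ k /2⌋)) (double≤⇒≤half (suc n) k le))))
  (ℚP.*-zeroʳ (sign k))

-- The sums of the two series: their z^n coefficients are the partial sums
-- up to the bounds beyond which all summands vanish at z^n.
x̂ S : Series
x̂ n = psum xTerm (suc n) n
S n = psum tTerm (double (suc n)) n

const1-⊛ : ∀ (g : ℕ → ℚ) m → Σ< (suc m) (λ i → const 1ℚ i * g i) ≡ g 0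
const1-⊛ g zero = solve 1 (λ x → con 0ℚ :+ con 1ℚ :* x := x) refl (g 0)
const1-⊛ g (suc m) rewrite const1-⊛ g m | ℚP.*-zeroˡ (g (suc m)) = ℚP.+-identityʳ _

expand-summand : ∀ b a′ a n
  → ((const 1ℚ ⊖ b) ⊛ (a′ ⊖ a)) n ≡ (a′ n - a n) - ((b ⊛ a′) n - (b ⊛ a) n)
expand-summand b a′ a n =
  begin
    Σ< (suc n) (λ i → (const 1ℚ i - b i) * (a′ (n ∸ i) - a (n ∸ i)))
  ≡⟨ Σ<-cong (suc n) _ _ (λ i → solve 4 (λ c x y w → (c :- x) :* (y :- w) := c :* (y :- w) :- (x :* y :- x :* w))
       refl (const 1ℚ i) (b i) (a′ (n ∸ i)) (a (n ∸ i))) ⟩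
    Σ< (suc n) (λ i → const 1ℚ i * (a′ (n ∸ i) - a (n ∸ i)) - (b i * a′ (n ∸ i) - b i * a (n ∸ i)))
  ≡⟨ Σ<-sub (suc n) _ _ ⟩
    Σ< (suc n) (λ i → const 1ℚ i * (a′ (n ∸ i) - a (n ∸ i))) - Σ< (suc n) (λ i → b i * a′ (n ∸ i) - b i * a (n ∸ i))
  ≡⟨ cong₂ _-_ (const1-⊛ (λ i → a′ (n ∸ i) - a (n ∸ i)) n) (Σ<-sub (suc n) _ _) ⟩
    (a′ n - a n) - ((b ⊛ a′) n - (b ⊛ a) n)
  ∎
  where open ≡-Reasoning

telescope : ∀ (a P Q : ℕ → ℚ) N
  → Σ< N (λ k → (a (suc k) - a k) - (Q k - P k)) ≡ (a N - a 0) + Σ< N (λ k → P k - Q k)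
telescope a P Q zero = solve 1 (λ x → con 0ℚ := (x :- x) :+ con 0ℚ) refl (a 0)
telescope a P Q (suc N) rewrite telescope a P Q N =
  solve 6 (λ a0 aN aN1 s p q → (aN :- a0) :+ s :+ ((aN1 :- aN) :- (q :- p))
      := (aN1 :- a0) :+ (s :+ (p :- q))) refl
    (a 0) (a N) (a (suc N)) (Σ< N (λ k → P k - Q k)) (P N) (Q N)

sign-even : ∀ k → sign (double k) ≡ 1ℚ
sign-even zero    = refl
sign-even (suc k) rewrite sign-even k = refl

half-even : ∀ k → ⌊ double k /2⌋ ≡ k
half-even zero    = refl
half-even (suc k) = cong suc (half-even k)

half-odd : ∀ k → ⌊ suc (double k) /2⌋ ≡ k
half-odd zero    = refl
half-odd (suc k) = cong suc (half-odd k)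

tTerm-pair : ∀ n k → tTerm (double k) n + tTerm (suc (double k)) n ≡ (β k ⊛ α k) n - (β k ⊛ α (suc k)) n
tTerm-pair n k rewrite sign-even k | half-even k | half-odd k =
  cong₂ _+_ (ℚP.*-identityˡ ((β k ⊛ α k) n)) odd-term
  where
  odd-term : (- 1ℚ) * (β k ⊛ α (suc k)) n ≡ - (β k ⊛ α (suc k)) n
  odd-term = solve 1 (λ x → (:- con 1ℚ) :* x := :- x) refl ((β k ⊛ α (suc k)) n)

-- x̂₀,₀ = 2(S - α₀) coefficientwise: at z^n the boundary term α_{n+1} vanishes.
x̂≡2[S-α₀] : ∀ n → x̂ n ≡ q2 * (S n - α₀ n)
x̂≡2[S-α₀] n =
  begin
    Σ< (suc n) (λ k → q2 * ((const 1ℚ ⊖ β k) ⊛ (α (suc k) ⊖ α k)) n)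
  ≡⟨ Σ<-scale q2 (suc n) _ ⟩
    q2 * Σ< (suc n) (λ k → ((const 1ℚ ⊖ β k) ⊛ (α (suc k) ⊖ α k)) n)
  ≡⟨ cong (q2 *_) (Σ<-cong (suc n) _ _ (λ k → expand-summand (β k) (α (suc k)) (α k) n)) ⟩
    q2 * Σ< (suc n) (λ k → (a (suc k) - a k) - (Q k - P k))
  ≡⟨ cong (q2 *_) (telescope a P Q (suc n)) ⟩
    q2 * ((a (suc n) - α₀ n) + Σ< (suc n) (λ k → P k - Q k))
  ≡⟨ cong (λ x → q2 * ((x - α₀ n) + Σ< (suc n) (λ k → P k - Q k))) (α-order (suc n) n ℕP.≤-refl) ⟩
    q2 * ((0ℚ - α₀ n) + Σ< (suc n) (λ k → P k - Q k))
  ≡⟨ cong (λ x → q2 * ((0ℚ - α₀ n) + x)) (sym S-pairs) ⟩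
    q2 * ((0ℚ - α₀ n) + S n)
  ≡⟨ solve 2 (λ s x → con q2 :* ((con 0ℚ :- x) :+ s) := con q2 :* (s :- x)) refl (S n) (α₀ n) ⟩
    q2 * (S n - α₀ n)
  ∎
  where
  open ≡-Reasoning
  a P Q : ℕ → ℚ
  a k = α k n
  P k = (β k ⊛ α k) n
  Q k = (β k ⊛ α (suc k)) n
  S-pairs : S n ≡ Σ< (suc n) (λ k → P k - Q k)
  S-pairs = trans (Σ<-pairs (λ j → tTerm j n) (suc n)) (Σ<-cong (suc n) _ _ (tTerm-pair n))

z⊛-const : ∀ X → (zS ⊛ X) 0 ≡ 0ℚ
z⊛-const X = solve 1 (λ x → con 0ℚ :+ con 0ℚ :* x := con 0ℚ) refl (X 0)

z⊛-shift : ∀ X m → (zS ⊛ X) (suc m) ≡ X m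
z⊛-shift X m = picks-index-1 (λ i → X (suc m ∸ i)) m
  where
  picks-index-1 : ∀ (g : ℕ → ℚ) j → Σ< (suc (suc j)) (λ i → zS i * g i) ≡ g 1
  picks-index-1 g zero = solve 2 (λ x y → (con 0ℚ :+ con 0ℚ :* x) :+ con 1ℚ :* y := y) refl (g 0) (g 1)
  picks-index-1 g (suc j) rewrite picks-index-1 g j | ℚP.*-zeroˡ (g (suc (suc j))) = ℚP.+-identityʳ _

h-rewrite : ∀ (X S′ A : Series) → (∀ n → X n ≡ q2 * (S′ n - A n))
  → h X ≈S (const 1ℚ ⊕ scale q2 (zS ⊛ (S′ ⊖ const 1ℚ ⊖ A)))
h-rewrite X S′ A X≡ zero =
  trans (cong ((1ℚ - q2 * 0ℚ) +_) (z⊛-const X))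
        (sym (cong (λ y → 1ℚ + q2 * y) (z⊛-const (S′ ⊖ const 1ℚ ⊖ A))))
h-rewrite X S′ A X≡ (suc m) =
  trans (cong ((0ℚ - q2 * zS (suc m)) +_) (trans (z⊛-shift X m) (X≡ m)))
        (trans (shifted m) (sym (cong (λ y → 0ℚ + q2 * y) (z⊛-shift (S′ ⊖ const 1ℚ ⊖ A) m))))
  where
  shifted : ∀ m → (0ℚ - q2 * zS (suc m)) + q2 * (S′ m - A m) ≡ 0ℚ + q2 * ((S′ m - const 1ℚ m) - A m)
  shifted m = trans
    (solve 3 (λ s a c → (con 0ℚ :- con q2 :* c) :+ con q2 :* (s :- a)
       := con 0ℚ :+ con q2 :* ((s :- c) :- a)) refl (S′ m) (A m) (zS (suc m)))
    (cong (λ c → 0ℚ + q2 * ((S′ m - c) - A m)) (zS-shift m))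
    where
    zS-shift : ∀ m → zS (suc m) ≡ const 1ℚ m
    zS-shift zero    = refl
    zS-shift (suc m) = refl


lemma17 : ∃[ x̂ ] ∃[ S ] (SumsTo xTerm x̂ × SumsTo tTerm S
    × h x̂ ≈S (const 1ℚ ⊕ scale q2 (zS ⊛ (S ⊖ const 1ℚ ⊖ α₀))))
lemma17 =
  x̂ , S ,
  eventually-vanishing-sums xTerm suc xTerm-vanishes ,
  eventually-vanishing-sums tTerm (λ n → double (suc n)) tTerm-vanishes ,
  h-rewrite x̂ S α₀ x̂≡2[S-α₀]
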